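{- Let $S_\infty$ be the infinite string over $\{\mathtt{a},\mathtt{b}\}$ with $S_\infty[i]=\mathtt{b}$ if $i=2^j$ for some integer $j\ge0$ and $S_\infty[i]=\mathtt{a}$ otherwise, and let $S_n=S_\infty[1\mathinner{.\,.} n]$. For every $n\ge1$, the string $S_n$ satisfies $\delta(S_n)\le2$ and $\gamma(S_n)\ge\frac12\lfloor\log n\rfloor$.
   Context: $d_k(S)$ is the number of distinct length-$k$ substrings of $S$ and $\delta(S)=\max\{d_k(S)/k : k\in[1\mathinner{.\,.} |S|]\}$. An attractor of $S[1\mathinner{.\,.} n]$ is a set $\Gamma\subseteq[1\mathinner{.\,.} n]$ such that every substring $S[i\mathinner{.\,.} j]$ has an occurrence $S[i'\mathinner{.\,.} j']=S[i\mathinner{.\,.} j]$ with $\Gamma\cap[i'\mathinner{.\,.} j']\neq\emptyset$; $\gamma(S)$ is the minimum attractor size. Logarithms are base 2. -}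

module Defs where

open import Data.Bool using (Bool; true; false)
open import Data.Bool.Properties using () renaming (_≟_ to _≟B_)
open import Data.Nat using (ℕ; zero; suc; _+_; _*_; _∸_; _^_; _≤_; _≟_)
open import Data.List using (List; []; _∷_; length; map; take; drop; upTo; foldr; deduplicate)
open import Data.Bool.ListAction using (any)
open import Data.List.Properties using (≡-dec)
open import Data.List.Membership.Propositional using (_∈_)
open import Data.List.Relation.Unary.All using (All)
open import Data.Integer using (+_)
open import Data.Rational using (ℚ; _/_; _⊔_; 0ℚ)
open import Data.Product using (Σ; ∃; _×_)
open import Relation.Binary.PropositionalEquality using (_≡_)
open import Relation.Nullary.Decidable using (⌊_⌋)

-- Strings are lists; positions are 1-indexed as in the paper.
-- 'a' is represented by false and 'b' by true.

-- isPow2 i = true iff i = 2^j for some j ≥ 0 (it suffices to test j ≤ i, since 2^j > j).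
isPow2 : ℕ → Bool
isPow2 i = any (λ j → ⌊ 2 ^ j ≟ i ⌋) (upTo (suc i))

S∞ : ℕ → Bool
S∞ i = isPow2 i

Sn : ℕ → List Bool
Sn n = map (λ t → S∞ (suc t)) (upTo n)

-- sub S i l = S[i .. i+l-1]  (1-indexed start position i)
sub : {A : Set} → List A → ℕ → ℕ → List A
sub S i l = take l (drop (i ∸ 1) S)

-- d_k(S): number of distinct length-k substrings of a binary string S
-- (start positions i ∈ [1 .. |S|-k+1]; none if k > |S|).
d : ℕ → List Bool → ℕ
d k S = length (deduplicate (≡-dec _≟B_)
          (map (λ t → sub S (suc t) k) (upTo ((suc (length S)) ∸ k))))

δ : List Bool → ℚ
δ S = foldr _⊔_ 0ℚ (map (λ t → (+ d (suc t) S) / suc t) (upTo (length S)))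

IsAttractor : {A : Set} → List A → List ℕ → Set
IsAttractor S Γ =
  All (λ p → 1 ≤ p × p ≤ length S) Γ ×
  (∀ i j → 1 ≤ i → i ≤ j → j ≤ length S →
    Σ ℕ λ i' → 1 ≤ i' × i' + (j ∸ i) ≤ length S ×
      sub S i' (suc (j ∸ i)) ≡ sub S i (suc (j ∸ i)) ×
      ∃ λ p → p ∈ Γ × i' ≤ p × p ≤ i' + (j ∸ i))

module Submission where

-- δ ≤ 2.  Fix k ≥ 1.  A window of length k starting at a position i ≥ k holds at
-- most one b: if 2^a < 2^c both lay in [i, i+k), then 2^c ≥ 2^a + 2^a ≥ 2i ≥ i + k.
-- So each length-k substring of S_n is either one of the k - 1 windows starting
-- before position k, or the all-a word, or one of the k words with a single b.
-- Hence d_k(S_n) ≤ 2k, and every ratio d_k(S_n)/k in the definition of δ is ≤ 2.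
--
-- γ ≥ ⌊log n⌋/2.  If 2^{j+1} ≤ n, the block S[2^j .. 2^{j+1}] = b a^{2^j-1} b occurs
-- only at 2^j: an occurrence must start with a b, i.e. at some 2^a, and a ≠ j would
-- align a b of one copy (at 2^{a+1} or 2^{j+1}) with an a of the other.  So every
-- attractor meets [2^j, 2^{j+1}].  For j = 0, 2, 4, … these intervals follow each
-- other strictly, so ⌈⌊log n⌋/2⌉ of them give that many distinct attractor points.

open import Defs
open import Data.Bool using (Bool; true; false)
open import Data.Bool.Properties using (T-≡; ¬-not) renaming (_≟_ to _≟B_)
open import Data.Nat using (ℕ; zero; suc; _+_; _*_; _∸_; _^_; _≤_; _<_; _≟_; z≤n; s≤s; z<s; s<s; ⌊_/2⌋; ⌈_/2⌉)
open import Data.Nat.Properties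
open import Data.Nat.Logarithm using (⌊log₂_⌋)
open import Data.Nat.Logarithm.Core using (⌊log2⌋)
open import Data.Nat.Induction using (<-wellFounded)
open import Induction.WellFounded using (Acc; acc)
open import Data.List using (List; []; _∷_; length; map; take; drop; upTo; applyUpTo; _++_; foldr)
open import Data.List.Properties using (∷-injective; map-upTo; length-applyUpTo; length-map; length-++; length-upTo; ≡-dec)
open import Data.List.Membership.Propositional using (_∈_; lose)
open import Data.List.Membership.Propositional.Properties using (∈-upTo⁺; ∈-upTo⁻; ∈-map⁺; ∈-map⁻; ∈-++⁺ˡ; ∈-++⁺ʳ; ∈-deduplicate⁻)
open import Data.List.Relation.Binary.Subset.Propositional using (_⊆_)
open import Data.List.Relation.Unary.Any using (here; there; satisfied)
open import Data.List.Relation.Unary.Any.Properties using (any⁺; any⁻)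
open import Data.List.Relation.Unary.All as All using (All; []; _∷_)
open import Data.List.Relation.Unary.Unique.Propositional using (Unique)
open import Data.List.Relation.Unary.Unique.DecPropositional.Properties (≡-dec _≟B_) using (deduplicate-!)
open import Data.List.Relation.Unary.AllPairs using ([]; _∷_)
open import Data.Integer as ℤ using (+_; +≤+)
open import Data.Integer.Properties using (pos-*)
open import Data.Rational using (ℚ; _/_; _⊔_; 0ℚ) renaming (_≤_ to _≤ℚ_)
open import Data.Rational.Properties using (toℚᵘ-cancel-≤; toℚᵘ-fromℚᵘ) renaming (⊔-lub to ⊔-lubℚ)
open import Data.Rational.Unnormalised using (mkℚᵘ; *≤*)
open import Data.Rational.Unnormalised.Properties using (≤-respʳ-≃; ≤-respˡ-≃; ≃-sym)
open import Data.Product using (Σ; ∃; _×_; _,_; proj₁; proj₂)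
open import Data.Empty using (⊥; ⊥-elim)
open import Function using (_∘_)
open import Function.Bundles using (Equivalence)
open import Relation.Nullary using (yes; no; contradiction)
open import Relation.Nullary.Decidable using (⌊_⌋; toWitness; fromWitness)
open import Relation.Binary.Definitions using (tri<; tri≈; tri>)
open import Relation.Binary.PropositionalEquality

applyUpTo-cong : {A : Set} (f g : ℕ → A) (l : ℕ) →
  (∀ {u} → u < l → f u ≡ g u) → applyUpTo f l ≡ applyUpTo g l
applyUpTo-cong f g zero    f≗g = refl
applyUpTo-cong f g (suc l) f≗g =
  cong₂ _∷_ (f≗g z<s) (applyUpTo-cong (f ∘ suc) (g ∘ suc) l (f≗g ∘ s<s))

applyUpTo-injective : {A : Set} (f g : ℕ → A) (l : ℕ) →
  applyUpTo f l ≡ applyUpTo g l → ∀ {u} → u < l → f u ≡ g u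
applyUpTo-injective f g (suc l) eq {zero}  _         = proj₁ (∷-injective eq)
applyUpTo-injective f g (suc l) eq {suc u} (s<s u<l) =
  applyUpTo-injective (f ∘ suc) (g ∘ suc) l (proj₂ (∷-injective eq)) u<l

drop-applyUpTo : {A : Set} (f : ℕ → A) (k l : ℕ) →
  drop k (applyUpTo f l) ≡ applyUpTo (λ t → f (k + t)) (l ∸ k)
drop-applyUpTo f zero    l       = refl
drop-applyUpTo f (suc k) zero    = refl
drop-applyUpTo f (suc k) (suc l) = drop-applyUpTo (f ∘ suc) k l

take-applyUpTo : {A : Set} (f : ℕ → A) {k l : ℕ} → k ≤ l →
  take k (applyUpTo f l) ≡ applyUpTo f k
take-applyUpTo f z≤n       = refl
take-applyUpTo f (s≤s k≤l) = cong (f 0 ∷_) (take-applyUpTo (f ∘ suc) k≤l)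

delete : {A : Set} {x : A} (ys : List A) → x ∈ ys → List A
delete (_ ∷ ys) (here _)    = ys
delete (y ∷ ys) (there x∈ys) = y ∷ delete ys x∈ys

length-delete : {A : Set} {x : A} (ys : List A) (x∈ys : x ∈ ys) →
  suc (length (delete ys x∈ys)) ≡ length ys
length-delete (_ ∷ ys) (here _)     = refl
length-delete (y ∷ ys) (there x∈ys) = cong suc (length-delete ys x∈ys)

∈-delete : {A : Set} {x y : A} (ys : List A) (x∈ys : x ∈ ys) →
  y ∈ ys → y ≢ x → y ∈ delete ys x∈ys
∈-delete (_ ∷ ys) (here refl)  (here refl)  y≢x = ⊥-elim (y≢x refl)
∈-delete (_ ∷ ys) (here refl)  (there y∈ys) y≢x = y∈ys
∈-delete (_ ∷ ys) (there x∈ys) (here refl)  y≢x = here refl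
∈-delete (_ ∷ ys) (there x∈ys) (there y∈ys) y≢x = there (∈-delete ys x∈ys y∈ys y≢x)

unique-⊆⇒length-≤ : {A : Set} {xs ys : List A} → Unique xs → xs ⊆ ys → length xs ≤ length ys
unique-⊆⇒length-≤ {xs = []}     _              _     = z≤n
unique-⊆⇒length-≤ {xs = x ∷ xs} {ys} (x∉xs ∷ uniq) xs⊆ys =
  subst (suc (length xs) ≤_) (length-delete ys x∈ys)
    (s≤s (unique-⊆⇒length-≤ uniq λ y∈xs →
      ∈-delete ys x∈ys (xs⊆ys (there y∈xs)) (λ y≡x → All.lookup x∉xs y∈xs (sym y≡x))))
  where x∈ys = xs⊆ys (here refl)

n<2^n : ∀ n → n < 2 ^ n
n<2^n zero    = z<s
n<2^n (suc n) = +-mono-≤ (m^n>0 2 n) (≤-trans (n<2^n n) (m≤m+n (2 ^ n) 0))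

2^suc : ∀ a → 2 ^ suc a ≡ 2 ^ a + 2 ^ a
2^suc a = cong (λ x → 2 ^ a + x) (+-identityʳ (2 ^ a))

2^-cancel-< : ∀ a b → 2 ^ a < 2 ^ b → a < b
2^-cancel-< a b lt = ≰⇒> (λ b≤a → <⇒≱ lt (^-monoʳ-≤ 2 b≤a))

2^-gap : ∀ a b → 2 ^ a < 2 ^ b → 2 ^ a + 2 ^ a ≤ 2 ^ b
2^-gap a b lt = subst (_≤ 2 ^ b) (2^suc a) (^-monoʳ-≤ 2 (2^-cancel-< a b lt))

no-pow-between : ∀ a c → 2 ^ a < 2 ^ c → 2 ^ c < 2 ^ suc a → ⊥
no-pow-between a c lo hi = <⇒≱ hi (^-monoʳ-≤ 2 (2^-cancel-< a c lo))

-- Position 2^j carries a b (the search bound in isPow2 suffices since j < 2^j).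
S∞-pow : ∀ j → S∞ (2 ^ j) ≡ true
S∞-pow j = Equivalence.to T-≡
  (any⁺ _ (lose (∈-upTo⁺ (s≤s (<⇒≤ (n<2^n j)))) (fromWitness {a? = 2 ^ j ≟ 2 ^ j} refl)))

S∞-true⇒pow : ∀ i → S∞ i ≡ true → ∃ λ j → 2 ^ j ≡ i
S∞-true⇒pow i b with satisfied (any⁻ _ (upTo (suc i)) (Equivalence.from T-≡ b))
... | j , 2^j≟i = j , toWitness {a? = 2 ^ j ≟ i} 2^j≟i

S∞-gap : ∀ a x → 2 ^ a < x → x < 2 ^ suc a → S∞ x ≡ false
S∞-gap a x lo hi with S∞ x in eq
... | false = refl
... | true with S∞-true⇒pow x eq
...   | c , refl = ⊥-elim (no-pow-between a c lo hi)

S∞-double : ∀ c → S∞ (2 ^ c + 2 ^ c) ≡ true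
S∞-double c = subst (λ x → S∞ x ≡ true) (2^suc c) (S∞-pow (suc c))

S∞-sum-distinct : ∀ {c e} → c < e → S∞ (2 ^ e + 2 ^ c) ≡ false
S∞-sum-distinct {c} {e} c<e = S∞-gap e (2 ^ e + 2 ^ c)
  (m<m+n (2 ^ e) (m^n>0 2 c))
  (subst (2 ^ e + 2 ^ c <_) (sym (2^suc e)) (+-monoʳ-< (2 ^ e) (^-monoʳ-< 2 (s≤s (s≤s z≤n)) c<e)))

Sn≡applyUpTo : ∀ n → Sn n ≡ applyUpTo (λ t → S∞ (suc t)) n
Sn≡applyUpTo = map-upTo (λ t → S∞ (suc t))

length-Sn : ∀ n → length (Sn n) ≡ n
length-Sn n = trans (cong length (Sn≡applyUpTo n)) (length-applyUpTo _ n)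

sub-Sn : ∀ n {i} l → 1 ≤ i → i + l ≤ suc n →
  sub (Sn n) i l ≡ applyUpTo (λ t → S∞ (i + t)) l
sub-Sn n {suc i} l _ (s≤s i+l≤n) = begin
  take l (drop i (Sn n))
    ≡⟨ cong (take l ∘ drop i) (Sn≡applyUpTo n) ⟩
  take l (drop i (applyUpTo (λ t → S∞ (suc t)) n))
    ≡⟨ cong (take l) (drop-applyUpTo _ i n) ⟩
  take l (applyUpTo (λ t → S∞ (suc i + t)) (n ∸ i))
    ≡⟨ take-applyUpTo _ (m+n≤o⇒m≤o∸n l (subst (_≤ n) (+-comm i l) i+l≤n)) ⟩
  applyUpTo (λ t → S∞ (suc i + t)) l ∎
  where open ≡-Reasoning

b's-far-apart : ∀ {i k u u'} → k ≤ i → u < u' → u' < k →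
  S∞ (i + u) ≡ true → S∞ (i + u') ≡ true → ⊥
b's-far-apart {i} {k} {u} {u'} k≤i u<u' u'<k b b'
  with S∞-true⇒pow (i + u) b | S∞-true⇒pow (i + u') b'
... | a , 2^a≡ | c , 2^c≡ = <-irrefl refl (begin-strict
  i + u'             <⟨ +-monoʳ-< i u'<k ⟩
  i + k              ≤⟨ +-mono-≤ (m≤m+n i u) (≤-trans k≤i (m≤m+n i u)) ⟩
  (i + u) + (i + u)  ≡⟨ cong₂ _+_ (sym 2^a≡) (sym 2^a≡) ⟩
  2 ^ a + 2 ^ a      ≤⟨ 2^-gap a c (subst₂ _<_ (sym 2^a≡) (sym 2^c≡) (+-monoʳ-< i u<u')) ⟩
  2 ^ c              ≡⟨ 2^c≡ ⟩
  i + u'             ∎)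
  where open ≤-Reasoning

AtMostOneTrue : ℕ → (ℕ → Bool) → Set
AtMostOneTrue k g = ∀ {u u'} → u < k → u' < k → g u ≡ true → g u' ≡ true → u ≡ u'

late-window-sparse : ∀ {i k} → k ≤ i → AtMostOneTrue k (λ u → S∞ (i + u))
late-window-sparse k≤i {u} {u'} u<k u'<k b b' with <-cmp u u'
... | tri< u<u' _ _ = ⊥-elim (b's-far-apart k≤i u<u' u'<k b b')
... | tri≈ _ u≡u' _ = u≡u'
... | tri> _ _ u'<u = ⊥-elim (b's-far-apart k≤i u'<u u<k b' b)

oneHot : ℕ → ℕ → List Bool
oneHot k r = applyUpTo (λ t → ⌊ t ≟ r ⌋) k

sparseWords : ℕ → List (List Bool)
sparseWords k = applyUpTo (λ _ → false) k ∷ map (oneHot k) (upTo k)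

sparse-∈ : ∀ k g → AtMostOneTrue k g → applyUpTo g k ∈ sparseWords k
sparse-∈ k g atMostOne with anyUpTo? (λ u → g u ≟B true) k
... | no noTrue = here (applyUpTo-cong g _ k λ {u} u<k → ¬-not λ b → noTrue (u , u<k , b))
... | yes (r , r<k , b) = there (subst (_∈ map (oneHot k) (upTo k))
                                   (sym (applyUpTo-cong g _ k onlyAtR))
                                   (∈-map⁺ (oneHot k) (∈-upTo⁺ r<k)))
  where
  onlyAtR : ∀ {t} → t < k → g t ≡ ⌊ t ≟ r ⌋
  onlyAtR {t} t<k with t ≟ r
  ... | yes refl = b
  ... | no t≢r   = ¬-not λ b' → t≢r (atMostOne t<k r<k b' b)

candidates : ℕ → ℕ → List (List Bool)
candidates n k' = map (λ t → sub (Sn n) (suc t) (suc k')) (upTo k') ++ sparseWords (suc k')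

-- k' early windows and k' + 2 sparse words: 2(k' + 1) candidates in all.
length-candidates : ∀ n k' → length (candidates n k') ≡ 2 * suc k'
length-candidates n k' = begin
  length (candidates n k')
    ≡⟨ length-++ (map (λ t → sub (Sn n) (suc t) (suc k')) (upTo k')) ⟩
  length (map _ (upTo k')) + suc (length (map (oneHot (suc k')) (upTo (suc k'))))
    ≡⟨ cong₂ (λ x y → x + suc y) (trans (length-map _ (upTo k')) (length-upTo k'))
                                 (trans (length-map _ (upTo (suc k'))) (length-upTo (suc k'))) ⟩
  k' + suc (suc k')
    ≡⟨ +-comm k' (suc (suc k')) ⟩
  suc (suc (k' + k'))
    ≡⟨ cong (λ x → suc (suc (k' + x))) (sym (+-identityʳ k')) ⟩
  suc (suc (k' + (k' + 0)))
    ≡⟨ cong suc (sym (+-suc k' (k' + 0))) ⟩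
  2 * suc k' ∎
  where open ≡-Reasoning

-- Every length-(k'+1) substring is a candidate: a window starting at t + 1 ≥ k' + 1
-- lies inside S_n, hence is a window of S∞ with at most one b.
substrings⊆candidates : ∀ n k' →
  map (λ t → sub (Sn n) (suc t) (suc k')) (upTo (suc (length (Sn n)) ∸ suc k')) ⊆ candidates n k'
substrings⊆candidates n k' x∈ with ∈-map⁻ _ x∈
... | t , t∈ , refl with t <? k'
...   | yes t<k' = ∈-++⁺ˡ (∈-map⁺ _ (∈-upTo⁺ t<k'))
...   | no  t≮k' = ∈-++⁺ʳ _ (subst (_∈ sparseWords k) (sym (sub-Sn n k (s≤s z≤n) fits))
                               (sparse-∈ k _ (late-window-sparse (s≤s (≮⇒≥ t≮k')))))
  where
  k = suc k'
  t<room : t < suc n ∸ k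
  t<room = subst (λ m → t < suc m ∸ k) (length-Sn n) (∈-upTo⁻ t∈)
  k≤1+n : k ≤ suc n
  k≤1+n = <⇒≤ (m∸n≢0⇒n<m (n>0⇒n≢0 (≤-trans (s≤s z≤n) t<room)))
  fits : suc t + k ≤ suc n
  fits = m≤o∸n⇒m+n≤o (suc t) k≤1+n t<room

-- d_k(S_n) ≤ 2k for every k ≥ 1: the distinct substrings form a duplicate-free
-- list inside the candidate list.
d-Sn≤ : ∀ n k' → d (suc k') (Sn n) ≤ 2 * suc k'
d-Sn≤ n k' = begin
  d (suc k') (Sn n)
    ≤⟨ unique-⊆⇒length-≤ (deduplicate-! _)
         (substrings⊆candidates n k' ∘ ∈-deduplicate⁻ (≡-dec _≟B_) _) ⟩
  length (candidates n k')
    ≡⟨ length-candidates n k' ⟩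
  2 * suc k' ∎
  where open ≤-Reasoning

frac-≤ : ∀ a b c e → a * suc e ≤ c * suc b → (+ a / suc b) ≤ℚ (+ c / suc e)
frac-≤ a b c e ae≤cb =
  toℚᵘ-cancel-≤ (≤-respʳ-≃ (≃-sym (toℚᵘ-fromℚᵘ (mkℚᵘ (+ c) e)))
                (≤-respˡ-≃ (≃-sym (toℚᵘ-fromℚᵘ (mkℚᵘ (+ a) b))) (*≤* cross)))
  where
  cross : (+ a) ℤ.* (+ suc e) ℤ.≤ (+ c) ℤ.* (+ suc b)
  cross = subst₂ ℤ._≤_ (pos-* a (suc e)) (pos-* c (suc b)) (+≤+ ae≤cb)

foldr-⊔-≤ : {A : Set} (f : A → ℚ) (q : ℚ) (xs : List A) →
  0ℚ ≤ℚ q → (∀ x → f x ≤ℚ q) → foldr _⊔_ 0ℚ (map f xs) ≤ℚ q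
foldr-⊔-≤ f q []       0≤q f≤q = 0≤q
foldr-⊔-≤ f q (x ∷ xs) 0≤q f≤q = ⊔-lubℚ (f≤q x) (foldr-⊔-≤ f q xs 0≤q f≤q)

δ≤2 : ∀ S → (∀ k' → d (suc k') S ≤ 2 * suc k') → δ S ≤ℚ (+ 2 / 1)
δ≤2 S d≤2k = foldr-⊔-≤ _ (+ 2 / 1) (upTo (length S)) (frac-≤ 0 0 2 0 z≤n)
  λ k' → frac-≤ (d (suc k') S) k' 2 0 (subst (_≤ 2 * suc k') (sym (*-identityʳ _)) (d≤2k k'))

occurrence-agree : ∀ n {i i' l} → 1 ≤ i → 1 ≤ i' → i + l ≤ suc n → i' + l ≤ suc n →
  sub (Sn n) i l ≡ sub (Sn n) i' l → ∀ {u} → u < l → S∞ (i + u) ≡ S∞ (i' + u)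
occurrence-agree n {l = l} 1≤i 1≤i' fits fits' same =
  applyUpTo-injective _ _ l (trans (sym (sub-Sn n l 1≤i fits)) (trans same (sub-Sn n l 1≤i' fits')))

AgreesWithBlock : ℕ → ℕ → Set
AgreesWithBlock j i = ∀ {u} → u ≤ 2 ^ j → S∞ (i + u) ≡ S∞ (2 ^ j + u)

agrees⇒starts-with-b : ∀ j i → AgreesWithBlock j i → S∞ i ≡ true
agrees⇒starts-with-b j i agree = begin
  S∞ i            ≡⟨ cong S∞ (sym (+-identityʳ i)) ⟩
  S∞ (i + 0)      ≡⟨ agree z≤n ⟩
  S∞ (2 ^ j + 0)  ≡⟨ cong S∞ (+-identityʳ (2 ^ j)) ⟩
  S∞ (2 ^ j)      ≡⟨ S∞-pow j ⟩
  true            ∎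
  where open ≡-Reasoning

-- A window at 2^a agreeing with the block at 2^j has a = j: otherwise the b at
-- 2^{min+1} faces an a strictly between 2^max and 2^{max+1}.
pow-block-rigid : ∀ a j → AgreesWithBlock j (2 ^ a) → a ≡ j
pow-block-rigid a j agree with <-cmp a j
... | tri< a<j _ _ = contradiction
        (trans (sym (S∞-double a)) (trans (agree (^-monoʳ-≤ 2 (<⇒≤ a<j))) (S∞-sum-distinct a<j)))
        λ ()
... | tri≈ _ a≡j _ = a≡j
... | tri> _ _ j<a = contradiction
        (trans (sym (S∞-sum-distinct j<a)) (trans (agree ≤-refl) (S∞-double j)))
        λ ()

-- The only window agreeing with the block at 2^j is the block itself: it starts
-- with a b, so at some 2^a, and then a = j.
block-start : ∀ j i → AgreesWithBlock j i → i ≡ 2 ^ j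
block-start j i agree with S∞-true⇒pow i (agrees⇒starts-with-b j i agree)
... | a , refl = cong (2 ^_) (pow-block-rigid a j agree)

unique-occurrence : ∀ n j {i} → 1 ≤ i → i + 2 ^ j ≤ n → 2 ^ j + 2 ^ j ≤ n →
  sub (Sn n) i (suc (2 ^ j)) ≡ sub (Sn n) (2 ^ j) (suc (2 ^ j)) → i ≡ 2 ^ j
unique-occurrence n j {i} 1≤i i-fits block-fits same =
  block-start j i λ u≤2^j →
    occurrence-agree n 1≤i (m^n>0 2 j) (extend i-fits) (extend block-fits) same (s≤s u≤2^j)
  where
  extend : ∀ {x} → x + 2 ^ j ≤ n → x + suc (2 ^ j) ≤ suc n
  extend {x} le = subst (_≤ suc n) (sym (+-suc x (2 ^ j))) (s≤s le)

HitOccurrence : {A : Set} → List A → List ℕ → ℕ → ℕ → Set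
HitOccurrence S Γ i l = Σ ℕ λ i' → 1 ≤ i' × i' + l ≤ length S ×
  sub S i' (suc l) ≡ sub S i (suc l) × ∃ λ p → p ∈ Γ × i' ≤ p × p ≤ i' + l

attractor-hit : {A : Set} {S : List A} {Γ : List ℕ} → IsAttractor S Γ →
  ∀ i l → 1 ≤ i → i + l ≤ length S → HitOccurrence S Γ i l
attractor-hit {S = S} {Γ} (_ , covers) i l 1≤i fits =
  subst (HitOccurrence S Γ i) (m+n∸m≡n i l) (covers i (i + l) 1≤i (m≤m+n i l) fits)

attractor-meets-block : ∀ n Γ j → IsAttractor (Sn n) Γ → 2 ^ suc j ≤ n →
  ∃ λ p → p ∈ Γ × 2 ^ j ≤ p × p ≤ 2 ^ suc j
attractor-meets-block n Γ j att fits
  with attractor-hit att (2 ^ j) (2 ^ j) (m^n>0 2 j) (subst₂ _≤_ (2^suc j) (sym (length-Sn n)) fits)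
... | i , 1≤i , i-fits , same , p , p∈Γ , i≤p , p≤
  with unique-occurrence n j 1≤i (subst (i + 2 ^ j ≤_) (length-Sn n) i-fits) (subst (_≤ n) (2^suc j) fits) same
...   | refl = p , p∈Γ , i≤p , subst (p ≤_) (sym (2^suc j)) p≤

separated-hits : (Γ : List ℕ) (a b : ℕ → ℕ) → (∀ i → b i < a (suc i)) →
  ∀ m → (∀ i → i < m → ∃ λ p → p ∈ Γ × a i ≤ p × p ≤ b i) →
  ∃ λ P → length P ≡ m × Unique P × P ⊆ Γ × All (_< a m) P
separated-hits Γ a b separated zero hits = [] , refl , [] , (λ ()) , []
separated-hits Γ a b separated (suc m) hits
  with separated-hits Γ a b separated m (λ i i<m → hits i (m<n⇒m<1+n i<m)) | hits m (n<1+n m)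
... | P , length≡m , uniqueP , P⊆Γ , P<a | p , p∈Γ , a≤p , p≤b =
  p ∷ P , cong suc length≡m , All.map p≢ P<a ∷ uniqueP , p∷P⊆Γ ,
  (p<a′ ∷ All.map (λ x<a → <-trans x<a (≤-<-trans a≤p p<a′)) P<a)
  where
  p<a′ : p < a (suc m)
  p<a′ = ≤-<-trans p≤b (separated m)
  p≢ : ∀ {x} → x < a m → p ≢ x
  p≢ x<a p≡x = <-irrefl (sym p≡x) (<-≤-trans x<a a≤p)
  p∷P⊆Γ : p ∷ P ⊆ Γ
  p∷P⊆Γ (here refl) = p∈Γ
  p∷P⊆Γ (there x∈P) = P⊆Γ x∈P

separated-hits⇒length : (Γ : List ℕ) (a b : ℕ → ℕ) → Unique Γ → (∀ i → b i < a (suc i)) →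
  ∀ m → (∀ i → i < m → ∃ λ p → p ∈ Γ × a i ≤ p × p ≤ b i) → m ≤ length Γ
separated-hits⇒length Γ a b uniqueΓ separated m hits
  with separated-hits Γ a b separated m hits
... | P , refl , uniqueP , P⊆Γ , _ = unique-⊆⇒length-≤ uniqueP P⊆Γ

-- 2⌊n/2⌋ ≤ n; since ⌈n/2⌉ is ⌊(n+1)/2⌋ by definition, also 2⌈n/2⌉ ≤ n + 1.
2*⌊n/2⌋≤n : ∀ n → 2 * ⌊ n /2⌋ ≤ n
2*⌊n/2⌋≤n zero          = z≤n
2*⌊n/2⌋≤n (suc zero)    = z≤n
2*⌊n/2⌋≤n (suc (suc n)) =
  subst (_≤ suc (suc n)) (sym (*-suc 2 ⌊ n /2⌋)) (s≤s (s≤s (2*⌊n/2⌋≤n n)))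

n≤2*⌈n/2⌉ : ∀ n → n ≤ 2 * ⌈ n /2⌉
n≤2*⌈n/2⌉ n = begin
  n                        ≡⟨ sym (⌊n/2⌋+⌈n/2⌉≡n n) ⟩
  ⌊ n /2⌋ + ⌈ n /2⌉        ≤⟨ +-monoˡ-≤ ⌈ n /2⌉ (⌊n/2⌋≤⌈n/2⌉ n) ⟩
  ⌈ n /2⌉ + ⌈ n /2⌉        ≡⟨ cong (λ x → ⌈ n /2⌉ + x) (sym (+-identityʳ ⌈ n /2⌉)) ⟩
  2 * ⌈ n /2⌉              ∎
  where open ≤-Reasoning

-- 2^⌊log₂ n⌋ ≤ n, following the recursion n ↦ ⌊n/2⌋ that defines ⌊log₂⌋.
2^⌊log2⌋≤ : ∀ n (rec : Acc _<_ n) → 1 ≤ n → 2 ^ ⌊log2⌋ n rec ≤ n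
2^⌊log2⌋≤ (suc zero)    _        _ = ≤-refl
2^⌊log2⌋≤ (suc (suc n)) (acc rs) _ = begin
  2 * 2 ^ ⌊log2⌋ (suc ⌊ n /2⌋) _  ≤⟨ *-monoʳ-≤ 2 (2^⌊log2⌋≤ (suc ⌊ n /2⌋) (rs (⌊n/2⌋<n (suc n))) (s≤s z≤n)) ⟩
  2 * suc ⌊ n /2⌋                 ≡⟨ *-suc 2 ⌊ n /2⌋ ⟩
  suc (suc (2 * ⌊ n /2⌋))         ≤⟨ s≤s (s≤s (2*⌊n/2⌋≤n n)) ⟩
  suc (suc n)                     ∎
  where open ≤-Reasoning

2^⌊log₂n⌋≤n : ∀ n → 1 ≤ n → 2 ^ ⌊log₂ n ⌋ ≤ n
2^⌊log₂n⌋≤n n = 2^⌊log2⌋≤ n (<-wellFounded n)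

-- Every duplicate-free attractor of S_n has at least ⌈⌊log₂ n⌋/2⌉ points: it meets
-- the separated blocks [2^{2i}, 2^{2i+1}] for 2i + 1 ≤ ⌊log₂ n⌋.
attractor-size : ∀ n → 1 ≤ n → ∀ Γ → Unique Γ → IsAttractor (Sn n) Γ →
  ⌊log₂ n ⌋ ≤ 2 * length Γ
attractor-size n 1≤n Γ uniqueΓ att = begin
  L              ≤⟨ n≤2*⌈n/2⌉ L ⟩
  2 * ⌈ L /2⌉    ≤⟨ *-monoʳ-≤ 2 (separated-hits⇒length Γ lower upper uniqueΓ separated ⌈ L /2⌉ hits) ⟩
  2 * length Γ   ∎
  where
  open ≤-Reasoning
  L = ⌊log₂ n ⌋
  lower upper : ℕ → ℕ
  lower i = 2 ^ (2 * i)
  upper i = 2 ^ suc (2 * i)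
  separated : ∀ i → upper i < lower (suc i)
  separated i = ^-monoʳ-< 2 (s≤s (s≤s z≤n)) (subst (suc (2 * i) <_) (sym (*-suc 2 i)) (n<1+n _))
  hits : ∀ i → i < ⌈ L /2⌉ → ∃ λ p → p ∈ Γ × lower i ≤ p × p ≤ upper i
  hits i i<m = attractor-meets-block n Γ (2 * i) att
    (≤-trans (^-monoʳ-≤ 2 exponent≤L) (2^⌊log₂n⌋≤n n 1≤n))
    where
    exponent≤L : suc (2 * i) ≤ L
    exponent≤L = ≤-pred (≤-trans (subst (_≤ 2 * ⌈ L /2⌉) (*-suc 2 i) (*-monoʳ-≤ 2 i<m))
                                 (2*⌊n/2⌋≤n (suc L)))

lemma4 : (n : ℕ) → 1 ≤ n →
    (δ (Sn n) ≤ℚ (+ 2 / 1)) ×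
    (∀ Γ → Unique Γ → IsAttractor (Sn n) Γ → ⌊log₂ n ⌋ ≤ 2 * length Γ)
lemma4 n 1≤n = δ≤2 (Sn n) (d-Sn≤ n) , attractor-size n 1≤n
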